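{- For all graphs $G,H$ and every $d\in\mathbb{N}_+$, there is an isomorphism $G\ltimes d+H\ltimes d\cong (G+H)\ltimes d$ and a graph homomorphism $G/d+H/d\to(G+H)/d$. Moreover, there exist graphs $G,H$ and $d\in\mathbb{N}_+$ such that there is no graph homomorphism $(G+H)/d\to G/d+H/d$.
   Context: Graphs are undirected simple graphs, possibly infinite. The join $G+H$ has vertex set $V(G)\sqcup V(H)$, the edges of $G$ and $H$, and all edges between $V(G)$ and $V(H)$. The lexicographic product $G\ltimes H$ has vertex set $V(G)\times V(H)$ with $(v,w)\sim(v',w')$ iff $v\sim v'$, or $v=v'$ and $w\sim w'$. The $d$-fold blowup is $G\ltimes d:=G\ltimes K_d$. The $d$-fractionalization $G/d$ is the graph whose vertices are the $d$-cliques of $G$, with $S\sim T$ iff $S\cap T=\emptyset$ and $s\sim t$ for all $s\in S,t\in T$. -}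

module Defs where

open import Data.Nat using (ℕ; suc; NonZero)
open import Data.Fin using (Fin; zero)
open import Data.Product using (Σ; _×_; _,_)
open import Data.Sum using (_⊎_; inj₁; inj₂)
open import Data.Unit using (⊤)
open import Data.Empty using (⊥)
open import Relation.Nullary using (¬_)
open import Relation.Binary.PropositionalEquality using (_≡_; _≢_; refl)
import Relation.Binary.PropositionalEquality as Eq
open import Function.Bundles using (_↔_; _⇔_; Inverse)

record Graph : Set₁ where
  field
    V     : Set
    E     : V → V → Set
    sym   : ∀ {x y} → E x y → E y x
    irrefl : ∀ {x} → ¬ E x x
open Graph public

Hom : Graph → Graph → Set
Hom G H = Σ (V G → V H) λ f → ∀ {x y} → E G x y → E H (f x) (f y)

Iso : Graph → Graph → Set
Iso G H = Σ (V G ↔ V H) λ f →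
  ∀ x y → E G x y ⇔ E H (Inverse.to f x) (Inverse.to f y)

JoinE : (G H : Graph) → V G ⊎ V H → V G ⊎ V H → Set
JoinE G H (inj₁ x) (inj₁ y) = E G x y
JoinE G H (inj₂ x) (inj₂ y) = E H x y
JoinE G H (inj₁ _) (inj₂ _) = ⊤
JoinE G H (inj₂ _) (inj₁ _) = ⊤

joinSym : (G H : Graph) → ∀ {x y} → JoinE G H x y → JoinE G H y x
joinSym G H {inj₁ x} {inj₁ y} e = sym G e
joinSym G H {inj₂ x} {inj₂ y} e = sym H e
joinSym G H {inj₁ x} {inj₂ y} e = _
joinSym G H {inj₂ x} {inj₁ y} e = _

joinIrr : (G H : Graph) → ∀ {x} → ¬ JoinE G H x x
joinIrr G H {inj₁ x} = irrefl G
joinIrr G H {inj₂ x} = irrefl H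

_⊕_ : Graph → Graph → Graph
G ⊕ H = record { V = V G ⊎ V H ; E = JoinE G H ; sym = λ {x} {y} → joinSym G H {x} {y} ; irrefl = λ {x} → joinIrr G H {x} }

-- d-fold blowup G ⋉ d := G ⋉ K_d (lexicographic product with K_d).
BlowE : (G : Graph) (d : ℕ) → V G × Fin d → V G × Fin d → Set
BlowE G d (v , w) (v' , w') = E G v v' ⊎ (v ≡ v' × w ≢ w')

blowup : Graph → ℕ → Graph
blowup G d = record
  { V = V G × Fin d
  ; E = BlowE G d
  ; sym = λ { (inj₁ e) → inj₁ (sym G e) ; (inj₂ (p , q)) → inj₂ (Eq.sym p , λ r → q (Eq.sym r)) }
  ; irrefl = λ { (inj₁ e) → irrefl G e ; (inj₂ (_ , q)) → q refl }
  }

-- d-cliques of G, represented by an enumeration Fin d → V G whose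
-- entries are pairwise adjacent (hence pairwise distinct).
Clique : Graph → ℕ → Set
Clique G d = Σ (Fin d → V G) λ s → ∀ i j → i ≢ j → E G (s i) (s j)

FracE : (G : Graph) (d : ℕ) → Clique G d → Clique G d → Set
FracE G d (s , _) (t , _) = (∀ i j → s i ≢ t j) × (∀ i j → E G (s i) (t j))

-- For d ≥ 1 this is a simple graph (for d = 0 the empty clique would be
-- adjacent to itself), so the construction requires NonZero d.
fraction : Graph → (d : ℕ) → .{{NonZero d}} → Graph
fraction G (suc n) = record
  { V = Clique G (suc n)
  ; E = FracE G (suc n)
  ; sym = λ { (dis , adj) → (λ i j p → dis j i (Eq.sym p)) , (λ i j → sym G (adj j i)) }
  ; irrefl = λ { {s , _} (dis , _) → dis zero zero refl }
  }

{-# OPTIONS --safe #-}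
module Submission where

-- Both sides of the first isomorphism have vertex set (V G ⊎ V H) × Fin d with the same
-- adjacency, and a d-clique of G or of H is a d-clique of G + H. The converse map cannot
-- exist because a clique of G + H may use vertices from both sides: for G = H = K₁ and
-- d = 2, the graph (G + H) / 2 has a vertex while G / 2 + H / 2 has none.

open import Defs
open import Data.Nat using (ℕ; NonZero; suc)
open import Data.Fin using (Fin; zero; suc)
open import Data.Product using (Σ; _×_; _,_; map₁)
open import Data.Product.Algebra using (×-distribʳ-⊎)
open import Data.Sum using (inj₁; inj₂; [_,_]′; map₂)
open import Data.Sum.Properties using (inj₁-injective; inj₂-injective)
open import Data.Unit using (⊤; tt)
open import Data.Empty using (⊥)
open import Function.Base using (_∘_; id; const)
open import Function.Bundles using (_↔_; _⇔_; Inverse; mk⇔)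
open import Function.Properties.Inverse using (↔-sym)
open import Relation.Nullary using (¬_; contradiction)
open import Relation.Binary.PropositionalEquality using (_≢_; refl; cong)

⊕-blowup-iso : (G H : Graph) (d : ℕ) → Iso (blowup G d ⊕ blowup H d) (blowup (G ⊕ H) d)
⊕-blowup-iso G H d = vertices , edges
  where
  vertices : V (blowup G d ⊕ blowup H d) ↔ V (blowup (G ⊕ H) d)
  vertices = ↔-sym (×-distribʳ-⊎ _ (Fin d) (V G) (V H))

  edges : ∀ x y → E (blowup G d ⊕ blowup H d) x y
                ⇔ E (blowup (G ⊕ H) d) (Inverse.to vertices x) (Inverse.to vertices y)
  edges (inj₁ _) (inj₁ _) = mk⇔ (map₂ (map₁ (cong inj₁))) (map₂ (map₁ inj₁-injective))
  edges (inj₂ _) (inj₂ _) = mk⇔ (map₂ (map₁ (cong inj₂))) (map₂ (map₁ inj₂-injective))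
  edges (inj₁ _) (inj₂ _) = mk⇔ inj₁ (const tt)
  edges (inj₂ _) (inj₁ _) = mk⇔ inj₁ (const tt)

map-Clique : ∀ {G G′} {d} → Hom G G′ → Clique G d → Clique G′ d
map-Clique (f , f-hom) (s , s-clique) = f ∘ s , λ i j i≢j → f-hom (s-clique i j i≢j)

⊕-inj₁ : (G H : Graph) → Hom G (G ⊕ H)
⊕-inj₁ G H = inj₁ , id

⊕-inj₂ : (G H : Graph) → Hom H (G ⊕ H)
⊕-inj₂ G H = inj₂ , id

⊕-fraction-hom : (G H : Graph) (d : ℕ) .{{_ : NonZero d}} →
                 Hom (fraction G d ⊕ fraction H d) (fraction (G ⊕ H) d)
⊕-fraction-hom G H (suc n) = clique , λ {x y} → preserves {x} {y}
  where
  clique : V (fraction G (suc n) ⊕ fraction H (suc n)) → V (fraction (G ⊕ H) (suc n))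
  clique = [ map-Clique {G} {G ⊕ H} (⊕-inj₁ G H) , map-Clique {H} {G ⊕ H} (⊕-inj₂ G H) ]′

  preserves : ∀ {x y} → E (fraction G (suc n) ⊕ fraction H (suc n)) x y
                      → E (fraction (G ⊕ H) (suc n)) (clique x) (clique y)
  preserves {inj₁ _} {inj₁ _} (disjoint , adjacent) = (λ i j → disjoint i j ∘ inj₁-injective) , adjacent
  preserves {inj₂ _} {inj₂ _} (disjoint , adjacent) = (λ i j → disjoint i j ∘ inj₂-injective) , adjacent
  preserves {inj₁ _} {inj₂ _} _ = (λ _ _ ()) , (λ _ _ → tt)
  preserves {inj₂ _} {inj₁ _} _ = (λ _ _ ()) , (λ _ _ → tt)

edgeless-no-Clique : (G : Graph) → (∀ {x y} → ¬ E G x y) → ∀ n → ¬ Clique G (suc (suc n))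
edgeless-no-Clique G edgeless n (_ , s-clique) = edgeless (s-clique zero (suc zero) λ ())

⊕-pair-Clique : (G H : Graph) → V G → V H → Clique (G ⊕ H) 2
⊕-pair-Clique G H x y = pair , adjacent
  where
  pair : Fin 2 → V (G ⊕ H)
  pair zero    = inj₁ x
  pair (suc _) = inj₂ y

  adjacent : ∀ i j → i ≢ j → E (G ⊕ H) (pair i) (pair j)
  adjacent zero       zero       i≢j = contradiction refl i≢j
  adjacent zero       (suc _)    _   = tt
  adjacent (suc _)    zero       _   = tt
  adjacent (suc zero) (suc zero) i≢j = contradiction refl i≢j

K₁ : Graph
K₁ = record { V = ⊤ ; E = λ _ _ → ⊥ ; sym = id ; irrefl = id }

K₁⊕K₁-fraction-no-hom : ¬ Hom (fraction (K₁ ⊕ K₁) 2) (fraction K₁ 2 ⊕ fraction K₁ 2)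
K₁⊕K₁-fraction-no-hom (f , _) = [ no-Clique , no-Clique ]′ (f (⊕-pair-Clique K₁ K₁ tt tt))
  where
  no-Clique : ¬ Clique K₁ 2
  no-Clique = edgeless-no-Clique K₁ id 0

lemma3p8 : ((G H : Graph) (d : ℕ) .{{_ : NonZero d}} →
               Iso (blowup G d ⊕ blowup H d) (blowup (G ⊕ H) d)
               × Hom (fraction G d ⊕ fraction H d) (fraction (G ⊕ H) d))
             × Σ Graph (λ G → Σ Graph (λ H → Σ ℕ (λ d → Σ (NonZero d) (λ nz →
                 ¬ Hom (fraction (G ⊕ H) d {{nz}}) (fraction G d {{nz}} ⊕ fraction H d {{nz}})))))
lemma3p8 = (λ G H d → ⊕-blowup-iso G H d , ⊕-fraction-hom G H d)
         , (K₁ , K₁ , 2 , _ , K₁⊕K₁-fraction-no-hom)
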